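{- Let $\ell$ be a positive integer such that there exists an affine plane of order $\ell-2$. Then there exists an $(\ell(\ell-2)^2, (\ell-1)(\ell-2), \ell-2)$-BIBD admitting a $0$-ULSE $\ell$-colouring.
   Context: An affine plane of order $n$ is an $(n^2,n,1)$-BIBD. For positive integers $v,k,\lambda$ with $2\le k<v$, a $(v,k,\lambda)$-BIBD is a pair $(V,\mathcal{B})$ where $V$ is a set of $v$ points and $\mathcal{B}$ is a collection of $k$-element subsets of $V$ (blocks) such that every pair of distinct points lies in exactly $\lambda$ blocks. An $\ell$-colouring of a BIBD is a surjective map from $V$ onto a set of $\ell$ colours. A $0$-ULSE $\ell$-colouring is an $\ell$-colouring such that $(\ell-1)$ divides $k$ and in every block exactly one colour does not appear, while each of the other $\ell-1$ colours appears exactly $\frac{k}{\ell-1}$ times in that block. -}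

module Defs where

open import Data.Nat using (ℕ; _≤_; _<_; _∸_; _*_)
open import Data.Fin using (Fin; _≟_)
open import Data.Fin.Subset using (Subset; _∈_; _∩_; ∣_∣)
open import Data.Fin.Subset.Properties using (_∈?_)
open import Data.Nat.Divisibility using (_∣_)
open import Data.List using (List; length; filter)
open import Data.List.Relation.Unary.All using (All)
open import Data.Vec using (tabulate)
open import Data.Product using (Σ; ∃; _×_; _,_)
open import Relation.Nullary using (¬_; does)
open import Relation.Nullary.Decidable using (_×-dec_)
open import Relation.Binary.PropositionalEquality using (_≡_)

-- A design on the point set Fin v: a (multi)set of blocks, given as a list
-- of subsets of the points (repeated blocks allowed).
Design : ℕ → Set
Design v = List (Subset v)

pairCount : ∀ {v} → Design v → Fin v → Fin v → ℕ
pairCount 𝓑 x y = length (filter (λ B → (x ∈? B) ×-dec (y ∈? B)) 𝓑)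

record IsBIBD (v k λ' : ℕ) (𝓑 : Design v) : Set where
  field
    k≥2      : 2 ≤ k
    k<v      : k < v
    blockSize : All (λ B → ∣ B ∣ ≡ k) 𝓑
    balanced : ∀ (x y : Fin v) → ¬ (x ≡ y) → pairCount 𝓑 x y ≡ λ'

BIBD : ℕ → ℕ → ℕ → Set
BIBD v k λ' = Σ (Design v) (IsBIBD v k λ')

AffinePlane : ℕ → Set
AffinePlane n = BIBD (n * n) n 1

Surjective : ∀ {v ℓ} → (Fin v → Fin ℓ) → Set
Surjective {v} {ℓ} col = ∀ (c : Fin ℓ) → ∃ λ (x : Fin v) → col x ≡ c

colourClass : ∀ {v ℓ} → (Fin v → Fin ℓ) → Fin ℓ → Subset v
colourClass col c = tabulate (λ x → does (col x ≟ c))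

colourCount : ∀ {v ℓ} → (Fin v → Fin ℓ) → Fin ℓ → Subset v → ℕ
colourCount col c B = ∣ B ∩ colourClass col c ∣

record IsZeroULSE {v : ℕ} (k ℓ : ℕ) (𝓑 : Design v) (col : Fin v → Fin ℓ) : Set where
  field
    surjective : Surjective col
    divides    : (ℓ ∸ 1) ∣ k
    perBlock   : All (λ B → Σ (Fin ℓ) λ c →
                     (colourCount col c B ≡ 0)
                   × (∀ (c' : Fin ℓ) → ¬ (c' ≡ c) →
                        colourCount col c' B ≡ _∣_.quotient divides)) 𝓑

module Submission where

-- Let n = ℓ − 2 and split the n² points of the affine plane into its n + 1 parallel
-- classes (Playfair's axiom, obtained by counting lines through a point). The new
-- points are pairs (d , x) of a colour d < ℓ and a point x of the plane, and the block
-- indexed by (c , p) contains, for each colour d ≢ c, the line through p of class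
-- ((c − d) mod ℓ) − 1 in colour d. So every block misses exactly colour c and meets
-- every other colour in n points. Two points of one colour d lie on a unique line, and
-- exactly one colour c ≢ d maps d to its class; the n points p of that line give the
-- n blocks through both. For two colours d ≢ e and each of the n colours c ∉ {d , e},
-- the classes assigned to d and e differ, so their lines through the two points meet
-- in exactly one p.

open import Defs
open import Algebra.Bundles using (CommutativeMonoid)
open import Data.Bool using (Bool; true; false; _∧_; _∨_; not)
open import Data.Bool.Properties
  using (∧-commutativeMonoid; ∧-comm; ∧-idem; ∧-zeroʳ; ∧-identityʳ; ∨-zeroʳ; ¬-not; not-injective; ⇔→≡)
open import Data.Fin as Fin
  using (Fin; zero; suc; toℕ; fromℕ<; pinch; _↑ˡ_; _↑ʳ_; combine; remQuot; quotient; _≟_)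
import Data.Fin.Properties as Finₚ
open import Data.Fin.Subset using (Subset; _∩_; ∣_∣)
open import Data.Fin.Subset.Properties using (_∈?_)
open import Data.List as List using (List; length; filter)
import Data.List.Properties as Listₚ
import Data.List.Relation.Unary.All as All
open import Data.List.Relation.Unary.All.Properties using (tabulate⁺)
open import Data.List.Membership.Propositional.Properties using (∈-lookup)
open import Data.Nat using (ℕ; zero; suc; _+_; _*_; _∸_; _≤_; _<_; z≤n; s≤s; _≤?_; _<?_; >-nonZero)
open import Data.Nat.Properties
  using ( +-*-semiring; +-comm; +-assoc; +-identityʳ; *-identityˡ; *-assoc; *-suc
        ; +-cancelˡ-≡; +-cancelʳ-≡; *-cancelʳ-≡; +-cancelˡ-<
        ; ≤-reflexive; ≤-trans; ≤-antisym; <⇒≤; ≤-<-trans; <-≤-trans; ≰⇒>; ≮⇒≥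
        ; n<1+n; n≢0⇒n>0; 1+n≢0
        ; +-mono-<; +-monoʳ-<; *-mono-≤; *-monoʳ-≤; *-monoˡ-<; ∸-monoˡ-≤; ∸-monoˡ-<
        ; m≤m+n; m≤m*n; m+n≮m; m+n≡0⇒n≡0; m∸n≤m
        ; m+n∸m≡n; m+n∸n≡m; m∸n+n≡m; m+[n∸m]≡n; m≤n⇒m∸n≡0 )
  renaming (_≟_ to _≟ℕ_)
open import Data.Nat.Divisibility using (m∣m*n)
open import Data.Product as Product using (Σ; ∃; _×_; _,_; proj₁; proj₂; uncurry)
open import Data.Vec as Vec using ([]; _∷_)
import Data.Vec.Properties as Vecₚ
open import Function using (_∘_; Injective)
open import Function.Bundles using (mk⇔)
open import Relation.Binary.PropositionalEquality
open import Relation.Nullary using (does; yes; no; contradiction)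
open import Relation.Nullary.Decidable using (decidable-stable; dec-true; dec-false; does-⇔; _×-dec_)
open import Relation.Unary using (Pred; Decidable)
open import Algebra.Properties.Semiring.Sum +-*-semiring
  using (sum; sum-cong-≗; sum-replicate-zero; ∑-comm; ∑-distrib-+; *-distribʳ-sum)
open import Algebra.Properties.CommutativeSemigroup (CommutativeMonoid.commutativeSemigroup ∧-commutativeMonoid)
  using () renaming (interchange to ∧-interchange)

-- Counting over finite sets

indicator : Bool → ℕ
indicator true  = 1
indicator false = 0

count : ∀ {m} → (Fin m → Bool) → ℕ
count P = sum (indicator ∘ P)

_==_ : ∀ {m} → Fin m → Fin m → Bool
i == j = does (i ≟ j)

==-refl : ∀ {m} (i : Fin m) → (i == i) ≡ true
==-refl i = dec-true (i ≟ i) refl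

==-≢ : ∀ {m} {i j : Fin m} → i ≢ j → (i == j) ≡ false
==-≢ {i = i} {j} = dec-false (i ≟ j)

==⇒≡ : ∀ {m} {i j : Fin m} → (i == j) ≡ true → i ≡ j
==⇒≡ {i = i} {j} eq with i ≟ j
... | yes i≡j = i≡j

==-false⇒≢ : ∀ {m} {i j : Fin m} → (i == j) ≡ false → i ≢ j
==-false⇒≢ {i = i} i=j refl = contradiction (trans (sym (==-refl i)) i=j) λ ()

==-sym : ∀ {m} (i j : Fin m) → (i == j) ≡ (j == i)
==-sym i j = does-⇔ (mk⇔ sym sym) (i ≟ j) (j ≟ i)

∧-true⁻ : ∀ {a b} → a ∧ b ≡ true → a ≡ true × b ≡ true
∧-true⁻ {true} b≡true = refl , b≡true

indicator-∧ : ∀ a b → indicator (a ∧ b) ≡ indicator a * indicator b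
indicator-∧ true  b = sym (+-identityʳ (indicator b))
indicator-∧ false b = refl

sum-zero : ∀ {m} (f : Fin m → ℕ) → (∀ i → f i ≡ 0) → sum f ≡ 0
sum-zero {m} f f≡0 = trans (sum-cong-≗ f≡0) (sum-replicate-zero m)

sum-single : ∀ {m} (i : Fin m) (f : Fin m → ℕ) → (∀ j → j ≢ i → f j ≡ 0) → sum f ≡ f i
sum-single zero f f≡0 =
  trans (cong (f zero +_) (sum-zero (f ∘ suc) (λ j → f≡0 (suc j) λ ()))) (+-identityʳ (f zero))
sum-single (suc i) f f≡0 =
  trans (cong (_+ sum (f ∘ suc)) (f≡0 zero λ ()))
        (sum-single i (f ∘ suc) (λ j j≢i → f≡0 (suc j) (j≢i ∘ Finₚ.suc-injective)))

sum-↑ : ∀ m {n} (f : Fin (m + n) → ℕ) → sum f ≡ sum (f ∘ (_↑ˡ n)) + sum (f ∘ (m ↑ʳ_))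
sum-↑ zero    f = refl
sum-↑ (suc m) f = trans (cong (f zero +_) (sum-↑ m (f ∘ suc))) (sym (+-assoc (f zero) _ _))

sum-combine : ∀ m {n} (f : Fin (m * n) → ℕ) → sum f ≡ sum (λ i → sum (λ j → f (combine {m} {n} i j)))
sum-combine zero        f = refl
sum-combine (suc m) {n} f =
  trans (sum-↑ n f) (cong (sum (λ j → f (j ↑ˡ m * n)) +_) (sum-combine m (f ∘ (n ↑ʳ_))))

count-cong : ∀ {m} {P Q : Fin m → Bool} → (∀ i → P i ≡ Q i) → count P ≡ count Q
count-cong P≗Q = sum-cong-≗ (cong indicator ∘ P≗Q)

count-none : ∀ {m} {P : Fin m → Bool} → (∀ i → P i ≡ false) → count P ≡ 0
count-none {P = P} P≡false = sum-zero (indicator ∘ P) (cong indicator ∘ P≡false)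

count-all : ∀ m → count {m} (λ _ → true) ≡ m
count-all zero    = refl
count-all (suc m) = cong suc (count-all m)

count-unique : ∀ {m} {P : Fin m → Bool} (i : Fin m) → P i ≡ true →
               (∀ j → P j ≡ true → j ≡ i) → count P ≡ 1
count-unique {P = P} i Pi unique =
  trans (sum-single i (indicator ∘ P) (λ j j≢i → cong indicator (¬-not (j≢i ∘ unique j))))
        (cong indicator Pi)

count-witness : ∀ {m} (P : Fin m → Bool) → count P ≢ 0 → ∃ λ i → P i ≡ true
count-witness {zero}  P count≢0 = contradiction refl count≢0
count-witness {suc m} P count≢0 with P zero in P0
... | true  = zero , P0
... | false with i , Pi ← count-witness (P ∘ suc) count≢0 = suc i , Pi

count-positive : ∀ {m} {P : Fin m → Bool} (i : Fin m) → P i ≡ true → count P ≢ 0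
count-positive {P = P} zero    P0 = subst (λ b → indicator b + count (P ∘ suc) ≢ 0) (sym P0) λ ()
count-positive {P = P} (suc i) Pi = count-positive i Pi ∘ m+n≡0⇒n≡0 (indicator (P zero))

count-split : ∀ {m} (P Q : Fin m → Bool) →
              count (λ i → P i ∧ Q i) + count (λ i → P i ∧ not (Q i)) ≡ count P
count-split P Q = trans (sym (∑-distrib-+ (λ i → indicator (P i ∧ Q i)) (λ i → indicator (P i ∧ not (Q i)))))
                        (sum-cong-≗ (λ i → split (P i) (Q i)))
  where
  split : ∀ a b → indicator (a ∧ b) + indicator (a ∧ not b) ≡ indicator a
  split true  true  = refl
  split true  false = refl
  split false _     = refl

count-remove : ∀ {m} (P : Fin m → Bool) (i : Fin m) → P i ≡ true →
               count (λ j → P j ∧ not (j == i)) ≡ count P ∸ 1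
count-remove P i Pi = begin
  rest                                  ≡⟨ m+n∸m≡n 1 rest ⟨
  1 + rest ∸ 1                          ≡⟨ cong (λ k → k + rest ∸ 1) only-i ⟨
  count (λ j → P j ∧ j == i) + rest ∸ 1 ≡⟨ cong (_∸ 1) (count-split P (_== i)) ⟩
  count P ∸ 1                           ∎
  where
  open ≡-Reasoning
  rest = count (λ j → P j ∧ not (j == i))
  only-i : count (λ j → P j ∧ j == i) ≡ 1
  only-i = count-unique i (cong₂ _∧_ Pi (==-refl i)) (λ j → ==⇒≡ ∘ proj₂ ∘ ∧-true⁻)

count-≢ : ∀ {m} (i : Fin m) → count (λ j → not (j == i)) ≡ m ∸ 1
count-≢ {m} i = trans (count-remove (λ _ → true) i refl) (cong (_∸ 1) (count-all m))

count≤1⇒unique : ∀ {m} {P : Fin m → Bool} → count P ≤ 1 →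
                 ∀ {i j} → P i ≡ true → P j ≡ true → i ≡ j
count≤1⇒unique {P = P} count≤1 {i} {j} Pi Pj with j ≟ i
... | yes j≡i = sym j≡i
... | no  j≢i = contradiction (trans (count-remove P i Pi) (m≤n⇒m∸n≡0 count≤1))
                              (count-positive j (cong₂ _∧_ Pj (cong not (==-≢ j≢i))))

count≡1⇒∃ : ∀ {m} {P : Fin m → Bool} → count P ≡ 1 → ∃ λ i → P i ≡ true
count≡1⇒∃ {P = P} count≡1 = count-witness P (1+n≢0 ∘ trans (sym count≡1))

count≡1⇒unique : ∀ {m} {P : Fin m → Bool} → count P ≡ 1 → ∀ {i j} → P i ≡ true → P j ≡ true → i ≡ j
count≡1⇒unique = count≤1⇒unique ∘ ≤-reflexive

unique⇒count≤1 : ∀ {m} {P : Fin m → Bool} →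
                 (∀ {i j} → P i ≡ true → P j ≡ true → i ≡ j) → count P ≤ 1
unique⇒count≤1 {P = P} unique with count P ≟ℕ 0
... | yes count≡0 = ≤-trans (≤-reflexive count≡0) z≤n
... | no  count≢0 with count-witness P count≢0
...   | i , Pi = ≤-reflexive (count-unique i Pi (λ j Pj → unique Pj Pi))

count-∧ˡ : ∀ {m} (a : Bool) (P : Fin m → Bool) → count (λ i → a ∧ P i) ≡ indicator a * count P
count-∧ˡ true  P = sym (+-identityʳ (count P))
count-∧ˡ false P = count-none {P = λ i → false ∧ P i} (λ _ → refl)

record Enumeration {m} (P : Fin m → Bool) (k : ℕ) : Set where
  field
    element   : Fin k → Fin m
    satisfies : ∀ i → P (element i) ≡ true
    injective : Injective _≡_ _≡_ element
    complete  : ∀ x → P x ≡ true → ∃ λ i → element i ≡ x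

enumerate : ∀ {m} (P : Fin m → Bool) → Enumeration P (count P)
enumerate {zero} P = record { element = λ () ; satisfies = λ () ; injective = λ {} ; complete = λ () }
enumerate {suc m} P with enumerate (P ∘ suc) | P zero in P0
... | E | true = record
  { element = element′ ; satisfies = satisfies′ ; injective = injective′ ; complete = complete′ }
  where
  open Enumeration E
  element′ : Fin (suc (count (P ∘ suc))) → Fin (suc m)
  element′ zero    = zero
  element′ (suc i) = suc (element i)
  satisfies′ : ∀ i → P (element′ i) ≡ true
  satisfies′ zero    = P0
  satisfies′ (suc i) = satisfies i
  injective′ : Injective _≡_ _≡_ element′
  injective′ {zero}  {zero}  _  = refl
  injective′ {suc i} {suc j} eq = cong suc (injective (Finₚ.suc-injective eq))
  complete′ : ∀ x → P x ≡ true → ∃ λ i → element′ i ≡ x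
  complete′ zero    _  = zero , refl
  complete′ (suc x) Px = Product.map suc (cong suc) (complete x Px)
... | E | false = record
  { element = suc ∘ element ; satisfies = satisfies
  ; injective = injective ∘ Finₚ.suc-injective ; complete = complete′ }
  where
  open Enumeration E
  complete′ : ∀ x → P x ≡ true → ∃ λ i → suc (element i) ≡ x
  complete′ zero    P0≡true = contradiction (trans (sym P0) P0≡true) λ ()
  complete′ (suc x) Px      = Product.map₂ (cong suc) (complete x Px)

does-∈? : ∀ {m} (x : Fin m) (p : Subset m) → does (x ∈? p) ≡ Vec.lookup p x
does-∈? zero    (true  ∷ p) = refl
does-∈? zero    (false ∷ p) = refl
does-∈? (suc x) (_     ∷ p) = does-∈? x p

∣p∣≡count : ∀ {m} (p : Subset m) → ∣ p ∣ ≡ count (Vec.lookup p)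
∣p∣≡count []          = refl
∣p∣≡count (true  ∷ p) = cong suc (∣p∣≡count p)
∣p∣≡count (false ∷ p) = ∣p∣≡count p

length-filter-tabulate : ∀ {a p} {A : Set a} {P : Pred A p} (P? : Decidable P) {k} (g : Fin k → A) →
                         length (filter P? (List.tabulate g)) ≡ count (λ j → does (P? (g j)))
length-filter-tabulate P? {zero}  g = refl
length-filter-tabulate P? {suc k} g with does (P? (g zero))
... | true  = cong suc (length-filter-tabulate P? (g ∘ suc))
... | false = length-filter-tabulate P? (g ∘ suc)

length-filter : ∀ {a p} {A : Set a} {P : Pred A p} (P? : Decidable P) (xs : List A) →
                length (filter P? xs) ≡ count (λ j → does (P? (List.lookup xs j)))
length-filter P? xs =
  trans (cong (length ∘ filter P?) (sym (Listₚ.tabulate-lookup xs))) (length-filter-tabulate P? (List.lookup xs))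

∣tabulate∣ : ∀ {m} (f : Fin m → Bool) → ∣ Vec.tabulate f ∣ ≡ count f
∣tabulate∣ f = trans (∣p∣≡count (Vec.tabulate f)) (count-cong (Vecₚ.lookup∘tabulate f))

∣tabulate∩tabulate∣ : ∀ {m} (f g : Fin m → Bool) →
                      ∣ Vec.tabulate f ∩ Vec.tabulate g ∣ ≡ count (λ i → f i ∧ g i)
∣tabulate∩tabulate∣ f g = trans (∣p∣≡count (Vec.tabulate f ∩ Vec.tabulate g)) (count-cong λ i →
  trans (Vecₚ.lookup-zipWith _∧_ i (Vec.tabulate f) (Vec.tabulate g))
        (cong₂ _∧_ (Vecₚ.lookup∘tabulate f i) (Vecₚ.lookup∘tabulate g i)))

does-∈?-tabulate : ∀ {m} (x : Fin m) (f : Fin m → Bool) → does (x ∈? Vec.tabulate f) ≡ f x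
does-∈?-tabulate x f = trans (does-∈? x (Vec.tabulate f)) (Vecₚ.lookup∘tabulate f x)

remQuot-injective : ∀ {m} n {i j : Fin (m * n)} → remQuot {m} n i ≡ remQuot {m} n j → i ≡ j
remQuot-injective {m} n {i} {j} eq =
  trans (sym (Finₚ.combine-remQuot {m} n i)) (trans (cong (uncurry combine) eq) (Finₚ.combine-remQuot {m} n j))

uncurryᶠ : ∀ {a} {A : Set a} {m n} → (Fin m → Fin n → A) → Fin (m * n) → A
uncurryᶠ {m = m} {n} G = uncurry G ∘ remQuot {m} n

count-uncurryᶠ : ∀ {m n} (G : Fin m → Fin n → Bool) → count (uncurryᶠ G) ≡ sum (λ i → count (G i))
count-uncurryᶠ {m} {n} G = trans (sum-combine m (indicator ∘ uncurryᶠ G))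
  (sum-cong-≗ λ i → sum-cong-≗ λ j → cong (indicator ∘ uncurry G) (Finₚ.remQuot-combine i j))

count-quotient : ∀ {m n} (G : Fin m → Fin n → Bool) (i : Fin m) →
                 count (λ z → uncurryᶠ G z ∧ quotient n z == i) ≡ count (G i)
count-quotient G i = begin
  count (uncurryᶠ (λ d x → G d x ∧ d == i))   ≡⟨ count-uncurryᶠ (λ d x → G d x ∧ d == i) ⟩
  sum (λ d → count (λ x → G d x ∧ d == i))    ≡⟨ sum-single i _ (λ d d≢i → count-none λ x →
                                                   trans (cong (G d x ∧_) (==-≢ d≢i)) (∧-zeroʳ (G d x))) ⟩
  count (λ x → G i x ∧ i == i)                ≡⟨ count-cong (λ x →
                                                   trans (cong (G i x ∧_) (==-refl i)) (∧-identityʳ (G i x))) ⟩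
  count (G i)                                 ∎
  where open ≡-Reasoning

-- Parallel classes of an affine plane

-- collinear i x y: y lies on the line of the i-th parallel class through x.
record ParallelClasses (v n : ℕ) : Set where
  field
    collinear       : Fin (suc n) → Fin v → Fin v → Bool
    line-size       : ∀ i x → count (collinear i x) ≡ n
    collinear-sym   : ∀ i x y → collinear i x y ≡ collinear i y x
    collinear-trans : ∀ i {x y z} → collinear i x y ≡ true → collinear i y z ≡ true → collinear i x z ≡ true
    unique-class    : ∀ {x y} → x ≢ y → count (λ i → collinear i x y) ≡ 1
    transversal     : ∀ {i j} → i ≢ j → ∀ x y → count (λ z → collinear i x z ∧ collinear j y z) ≡ 1

  same-line : ∀ i {x y} → collinear i x y ≡ true → ∀ z → collinear i x z ≡ collinear i y z
  same-line i x~y z = ⇔→≡ (mk⇔ (collinear-trans i (trans (collinear-sym i _ _) x~y)) (collinear-trans i x~y))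

  common-points : ∀ i x y → count (λ z → collinear i x z ∧ collinear i y z) ≡ indicator (collinear i x y) * n
  common-points i x y with collinear i x y in x~y
  ... | true  = begin
    count (λ z → collinear i x z ∧ collinear i y z)
      ≡⟨ count-cong (λ z → cong (_∧ collinear i y z) (same-line i x~y z)) ⟩
    count (λ z → collinear i y z ∧ collinear i y z) ≡⟨ count-cong (λ z → ∧-idem (collinear i y z)) ⟩
    count (collinear i y)                           ≡⟨ line-size i y ⟩
    n                                               ≡⟨ +-identityʳ n ⟨
    1 * n                                           ∎
    where open ≡-Reasoning
  ... | false = count-none λ z → ¬-not λ x~z∧y~z →
    let (x~z , y~z) = ∧-true⁻ x~z∧y~z
    in contradiction (trans (sym (collinear-trans i x~z (trans (collinear-sym i z y) y~z))) x~y) λ ()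

[1+n]*[n∸1]≡n*n∸1 : ∀ n → suc n * (n ∸ 1) ≡ n * n ∸ 1
[1+n]*[n∸1]≡n*n∸1 zero    = refl
[1+n]*[n∸1]≡n*n∸1 (suc m) = cong (m +_) (sym (*-suc m m))

module AffinePlaneGeometry {n : ℕ} {𝓑 : Design (n * n)} (plane : IsBIBD (n * n) n 1 𝓑) where
  open IsBIBD plane
  open ≡-Reasoning

  Point : Set
  Point = Fin (n * n)

  Line : Set
  Line = Fin (length 𝓑)

  infix 7 _∈ᵇ_
  _∈ᵇ_ : Point → Line → Bool
  x ∈ᵇ L = Vec.lookup (List.lookup 𝓑 L) x

  line-size : ∀ L → count (_∈ᵇ L) ≡ n
  line-size L = trans (sym (∣p∣≡count (List.lookup 𝓑 L))) (All.lookup blockSize (∈-lookup L))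

  lines-through-pair : ∀ {x y} → x ≢ y → count (λ L → x ∈ᵇ L ∧ y ∈ᵇ L) ≡ 1
  lines-through-pair {x} {y} x≢y = begin
    count (λ L → x ∈ᵇ L ∧ y ∈ᵇ L)
      ≡⟨ count-cong (λ L → cong₂ _∧_ (does-∈? x (List.lookup 𝓑 L)) (does-∈? y (List.lookup 𝓑 L))) ⟨
    count (λ L → does ((x ∈? List.lookup 𝓑 L) ×-dec (y ∈? List.lookup 𝓑 L)))
                                   ≡⟨ length-filter (λ B → (x ∈? B) ×-dec (y ∈? B)) 𝓑 ⟨
    pairCount 𝓑 x y               ≡⟨ balanced x y x≢y ⟩
    1                              ∎

  line-unique : ∀ {x y L M} → x ≢ y →
                x ∈ᵇ L ≡ true → y ∈ᵇ L ≡ true → x ∈ᵇ M ≡ true → y ∈ᵇ M ≡ true → L ≡ M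
  line-unique x≢y xL yL xM yM =
    count≡1⇒unique (lines-through-pair x≢y) (cong₂ _∧_ xL yL) (cong₂ _∧_ xM yM)

  -- Counting the flags (L , y) with p, y ∈ L and y ≢ p in two ways: (n ∸ 1) · deg p = n² ∸ 1.
  degree : ∀ p → count (p ∈ᵇ_) ≡ suc n
  degree p = *-cancelʳ-≡ (count (p ∈ᵇ_)) (suc n) (n ∸ 1) {{>-nonZero (∸-monoˡ-≤ 1 k≥2)}} (begin
    count (p ∈ᵇ_) * (n ∸ 1)                   ≡⟨ *-distribʳ-sum (n ∸ 1) (indicator ∘ (p ∈ᵇ_)) ⟩
    sum (λ L → indicator (p ∈ᵇ L) * (n ∸ 1))  ≡⟨ sum-cong-≗ others-on-line ⟨
    sum (λ L → count (λ y → flag L y))        ≡⟨ ∑-comm (λ L y → indicator (flag L y)) ⟩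
    sum (λ y → count (λ L → flag L y))        ≡⟨ sum-cong-≗ lines-to-point ⟩
    count (λ y → not (y == p))                ≡⟨ count-≢ p ⟩
    n * n ∸ 1                                 ≡⟨ [1+n]*[n∸1]≡n*n∸1 n ⟨
    suc n * (n ∸ 1)                           ∎)
    where
    flag : Line → Point → Bool
    flag L y = p ∈ᵇ L ∧ (y ∈ᵇ L ∧ not (y == p))
    others-on-line : ∀ L → count (λ y → flag L y) ≡ indicator (p ∈ᵇ L) * (n ∸ 1)
    others-on-line L with p ∈ᵇ L in p∈L
    ... | true  = trans (trans (count-remove (_∈ᵇ L) p p∈L) (cong (_∸ 1) (line-size L)))
                        (sym (+-identityʳ (n ∸ 1)))
    ... | false = count-none {P = λ y → false ∧ (y ∈ᵇ L ∧ not (y == p))} (λ _ → refl)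
    lines-to-point : ∀ y → count (λ L → flag L y) ≡ indicator (not (y == p))
    lines-to-point y with y == p in y=p
    ... | true  = count-none (λ L → trans (cong (p ∈ᵇ L ∧_) (∧-zeroʳ (y ∈ᵇ L))) (∧-zeroʳ (p ∈ᵇ L)))
    ... | false = trans (count-cong (λ L → cong (p ∈ᵇ L ∧_) (∧-identityʳ (y ∈ᵇ L))))
                        (lines-through-pair (≢-sym (==-false⇒≢ y=p)))

  meet : Line → Line → ℕ
  meet L M = count (λ x → x ∈ᵇ L ∧ x ∈ᵇ M)

  meet≤1 : ∀ {L M} → L ≢ M → meet L M ≤ 1
  meet≤1 {L} {M} L≢M = unique⇒count≤1 same-point
    where
    same-point : ∀ {x y} → (x ∈ᵇ L ∧ x ∈ᵇ M) ≡ true → (y ∈ᵇ L ∧ y ∈ᵇ M) ≡ true → x ≡ y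
    same-point {x} {y} x∈LM y∈LM with x ≟ y | ∧-true⁻ x∈LM | ∧-true⁻ y∈LM
    ... | yes x≡y | _ | _ = x≡y
    ... | no  x≢y | xL , xM | yL , yM = contradiction (line-unique x≢y xL yL xM yM) L≢M

  disjoint : Line → Line → Bool
  disjoint L M = does (meet L M ≟ℕ 0)

  disjoint⇒meet≡0 : ∀ {L M} → disjoint L M ≡ true → meet L M ≡ 0
  disjoint⇒meet≡0 {L} {M} L∥M = decidable-stable (meet L M ≟ℕ 0) λ meet≢0 →
    contradiction (trans (sym L∥M) (dec-false (meet L M ≟ℕ 0) meet≢0)) λ ()

  ¬disjoint⇒common-point : ∀ {L M} → disjoint L M ≡ false → ∃ λ x → (x ∈ᵇ L ∧ x ∈ᵇ M) ≡ true
  ¬disjoint⇒common-point {L} {M} L∦M =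
    count-witness (λ x → x ∈ᵇ L ∧ x ∈ᵇ M) λ meet≡0 →
      contradiction (trans (sym (dec-true (meet L M ≟ℕ 0) meet≡0)) L∦M) λ ()

  lines-meeting : ∀ {p L} → p ∈ᵇ L ≡ false → sum (λ M → indicator (p ∈ᵇ M) * meet M L) ≡ n
  lines-meeting {p} {L} p∉L = begin
    sum (λ M → indicator (p ∈ᵇ M) * meet M L)
      ≡⟨ sum-cong-≗ (λ M → count-∧ˡ (p ∈ᵇ M) (λ x → x ∈ᵇ M ∧ x ∈ᵇ L)) ⟨
    sum (λ M → count (λ x → p ∈ᵇ M ∧ (x ∈ᵇ M ∧ x ∈ᵇ L)))
      ≡⟨ ∑-comm (λ M x → indicator (p ∈ᵇ M ∧ (x ∈ᵇ M ∧ x ∈ᵇ L))) ⟩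
    sum (λ x → count (λ M → p ∈ᵇ M ∧ (x ∈ᵇ M ∧ x ∈ᵇ L)))
      ≡⟨ sum-cong-≗ lines-joining ⟩
    count (_∈ᵇ L)
      ≡⟨ line-size L ⟩
    n ∎
    where
    lines-joining : ∀ x → count (λ M → p ∈ᵇ M ∧ (x ∈ᵇ M ∧ x ∈ᵇ L)) ≡ indicator (x ∈ᵇ L)
    lines-joining x with x ∈ᵇ L in x∈L
    ... | true  = trans (count-cong (λ M → cong (p ∈ᵇ M ∧_) (∧-identityʳ (x ∈ᵇ M))))
                        (lines-through-pair λ { refl → contradiction (trans (sym p∉L) x∈L) λ () })
    ... | false = count-none (λ M → trans (cong (p ∈ᵇ M ∧_) (∧-zeroʳ (x ∈ᵇ M))) (∧-zeroʳ (p ∈ᵇ M)))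

  -- Through p ∉ L there are n + 1 lines; n of them meet L (one through each point of L,
  -- each meeting it once), so exactly one is disjoint from L.
  playfair : ∀ {p L} → p ∈ᵇ L ≡ false → count (λ M → p ∈ᵇ M ∧ disjoint M L) ≡ 1
  playfair {p} {L} p∉L = +-cancelʳ-≡ n _ 1 (begin
    count (λ M → p ∈ᵇ M ∧ disjoint M L) + n
      ≡⟨ cong (count (λ M → p ∈ᵇ M ∧ disjoint M L) +_) (lines-meeting p∉L) ⟨
    count (λ M → p ∈ᵇ M ∧ disjoint M L) + sum (λ M → indicator (p ∈ᵇ M) * meet M L)
      ≡⟨ ∑-distrib-+ (λ M → indicator (p ∈ᵇ M ∧ disjoint M L)) (λ M → indicator (p ∈ᵇ M) * meet M L) ⟨
    sum (λ M → indicator (p ∈ᵇ M ∧ disjoint M L) + indicator (p ∈ᵇ M) * meet M L)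
      ≡⟨ sum-cong-≗ disjoint-or-meeting ⟩
    count (p ∈ᵇ_)
      ≡⟨ degree p ⟩
    1 + n ∎)
    where
    none-or-one : ∀ k → k ≤ 1 → indicator (does (k ≟ℕ 0)) + (k + 0) ≡ 1
    none-or-one 0 _ = refl
    none-or-one 1 _ = refl
    none-or-one (suc (suc _)) (s≤s ())
    disjoint-or-meeting : ∀ M →
      indicator (p ∈ᵇ M ∧ disjoint M L) + indicator (p ∈ᵇ M) * meet M L ≡ indicator (p ∈ᵇ M)
    disjoint-or-meeting M with p ∈ᵇ M in p∈M
    ... | true  = none-or-one (meet M L) (meet≤1 λ { refl → contradiction (trans (sym p∈M) p∉L) λ () })
    ... | false = refl

  parallel : Line → Line → Bool
  parallel L M = L == M ∨ disjoint L M

  parallel-refl : ∀ L → parallel L L ≡ true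
  parallel-refl L = cong (_∨ disjoint L L) (==-refl L)

  parallel-sym : ∀ L M → parallel L M ≡ parallel M L
  parallel-sym L M = cong₂ _∨_ (==-sym L M)
    (cong (λ k → does (k ≟ℕ 0)) (count-cong (λ x → ∧-comm (x ∈ᵇ L) (x ∈ᵇ M))))

  parallel-through : ∀ p L → count (λ M → p ∈ᵇ M ∧ parallel M L) ≡ 1
  parallel-through p L with p ∈ᵇ L in p∈L
  ... | true  = count-unique L (cong₂ _∧_ p∈L (parallel-refl L)) only-L
    where
    only-L : ∀ M → (p ∈ᵇ M ∧ parallel M L) ≡ true → M ≡ L
    only-L M p∈M∥L with M ≟ L | ∧-true⁻ p∈M∥L
    ... | yes M≡L | _ = M≡L
    ... | no  M≢L | p∈M , M∥L = contradiction
      (disjoint⇒meet≡0 (trans (sym (cong (_∨ disjoint M L) (==-≢ M≢L))) M∥L))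
      (count-positive p (cong₂ _∧_ p∈M p∈L))
  ... | false = trans (count-cong not-L) (playfair p∈L)
    where
    not-L : ∀ M → (p ∈ᵇ M ∧ parallel M L) ≡ (p ∈ᵇ M ∧ disjoint M L)
    not-L M with p ∈ᵇ M in p∈M
    ... | false = refl
    ... | true  = cong (_∨ disjoint M L) (==-≢ {i = M} {L} λ { refl → contradiction (trans (sym p∈M) p∈L) λ () })

  parallel-unique : ∀ {p L M M′} → p ∈ᵇ M ≡ true → parallel M L ≡ true →
                    p ∈ᵇ M′ ≡ true → parallel M′ L ≡ true → M ≡ M′
  parallel-unique {p} {L} p∈M M∥L p∈M′ M′∥L =
    count≡1⇒unique (parallel-through p L) (cong₂ _∧_ p∈M M∥L) (cong₂ _∧_ p∈M′ M′∥L)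

  parallel-trans : ∀ {L M N} → parallel L M ≡ true → parallel M N ≡ true → parallel L N ≡ true
  parallel-trans {L} {M} {N} L∥M M∥N with disjoint L N in L∥N
  ... | true  = ∨-zeroʳ (L == N)
  ... | false with q , q∈LN ← ¬disjoint⇒common-point L∥N
              with q∈L , q∈N ← ∧-true⁻ q∈LN
              with refl ← parallel-unique {q} {M} {L} {N} q∈L L∥M q∈N (trans (parallel-sym N M) M∥N)
              = cong (_∨ false) (==-refl L)

  origin : Point
  origin = fromℕ< (*-mono-≤ 1≤n 1≤n)
    where
    1≤n : 1 ≤ n
    1≤n = ≤-trans (s≤s z≤n) k≥2

  -- Parallel classes are indexed by the n + 1 lines through origin. The pencil and the chosen
  -- parallels are opaque: unfolding them during conversion checking is prohibitively slow.
  opaque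
    pencil : Enumeration (origin ∈ᵇ_) (suc n)
    pencil = subst (Enumeration (origin ∈ᵇ_)) (degree origin) (enumerate (origin ∈ᵇ_))

  open Enumeration pencil public using () renaming
    ( element to direction; satisfies to origin∈direction
    ; injective to direction-injective; complete to direction-complete )

  direction-of : ∀ L → ∃ λ i → parallel L (direction i) ≡ true
  direction-of L
    with D , origin∈D∥L ← count≡1⇒∃ {P = λ M → origin ∈ᵇ M ∧ parallel M L} (parallel-through origin L)
    with origin∈D , D∥L ← ∧-true⁻ origin∈D∥L
    with i , direction-i≡D ← direction-complete D origin∈D
    = i , subst (λ M → parallel L M ≡ true) (sym direction-i≡D) (trans (parallel-sym L D) D∥L)

  parallel-through-witness : ∀ i x → ∃ λ M → (x ∈ᵇ M ∧ parallel M (direction i)) ≡ true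
  parallel-through-witness i x =
    count≡1⇒∃ {P = λ M → x ∈ᵇ M ∧ parallel M (direction i)} (parallel-through x (direction i))

  opaque
    parallelThrough : Fin (suc n) → Point → Line
    parallelThrough i x = proj₁ (parallel-through-witness i x)

    ∈-parallelThrough : ∀ i x → x ∈ᵇ parallelThrough i x ≡ true
    ∈-parallelThrough i x = proj₁ (∧-true⁻ (proj₂ (parallel-through-witness i x)))

    parallelThrough-∥ : ∀ i x → parallel (parallelThrough i x) (direction i) ≡ true
    parallelThrough-∥ i x = proj₂ (∧-true⁻ (proj₂ (parallel-through-witness i x)))

  parallelThrough-unique : ∀ {i x M} → x ∈ᵇ M ≡ true → parallel M (direction i) ≡ true → parallelThrough i x ≡ M
  parallelThrough-unique {i} {x} {M} = parallel-unique {x} {direction i} (∈-parallelThrough i x) (parallelThrough-∥ i x)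

  parallelThrough-parallel⇒≡ : ∀ {i x j y} → parallel (parallelThrough i x) (parallelThrough j y) ≡ true → i ≡ j
  parallelThrough-parallel⇒≡ {i} {x} {j} {y} Lᵢ∥Lⱼ = direction-injective (parallel-unique {origin} {direction j}
    (origin∈direction i)
    (parallel-trans (parallel-trans (trans (parallel-sym (direction i) _) (parallelThrough-∥ i x)) Lᵢ∥Lⱼ)
                    (parallelThrough-∥ j y))
    (origin∈direction j) (parallel-refl (direction j)))

  collinear : Fin (suc n) → Point → Point → Bool
  collinear i x y = y ∈ᵇ parallelThrough i x

  same-parallel : ∀ {i x y} → collinear i x y ≡ true → parallelThrough i y ≡ parallelThrough i x
  same-parallel {i} {x} x~y = parallelThrough-unique x~y (parallelThrough-∥ i x)

  collinear-sym : ∀ i x y → collinear i x y ≡ collinear i y x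
  collinear-sym i x y = ⇔→≡ (mk⇔ (flip x y) (flip y x))
    where
    flip : ∀ x y → collinear i x y ≡ true → collinear i y x ≡ true
    flip x y x~y = subst (λ M → x ∈ᵇ M ≡ true) (sym (same-parallel x~y)) (∈-parallelThrough i x)

  collinear-trans : ∀ i {x y z} → collinear i x y ≡ true → collinear i y z ≡ true → collinear i x z ≡ true
  collinear-trans i {z = z} x~y y~z = subst (λ M → z ∈ᵇ M ≡ true) (same-parallel x~y) y~z

  unique-class : ∀ {x y} → x ≢ y → count (λ i → collinear i x y) ≡ 1
  unique-class {x} {y} x≢y
    with L , x,y∈L ← count≡1⇒∃ {P = λ L → x ∈ᵇ L ∧ y ∈ᵇ L} (lines-through-pair x≢y)
    with x∈L , y∈L ← ∧-true⁻ x,y∈L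
    with i , L∥ ← direction-of L
    = count-unique i (subst (λ M → y ∈ᵇ M ≡ true) (sym (parallelThrough-unique x∈L L∥)) y∈L) only-i
    where
    only-i : ∀ j → collinear j x y ≡ true → j ≡ i
    only-i j x~y = parallelThrough-parallel⇒≡ (subst (λ M → parallel (parallelThrough j x) M ≡ true)
      (trans (line-unique x≢y (∈-parallelThrough j x) x~y x∈L y∈L) (sym (parallelThrough-unique x∈L L∥)))
      (parallel-refl (parallelThrough j x)))

  transversal : ∀ {i j} → i ≢ j → ∀ x y → count (λ z → collinear i x z ∧ collinear j y z) ≡ 1
  transversal {i} {j} i≢j x y = ≤-antisym (meet≤1 L≢M) (n≢0⇒n>0 meet≢0)
    where
    L = parallelThrough i x
    M = parallelThrough j y
    L∦M : parallel L M ≢ true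
    L∦M = i≢j ∘ parallelThrough-parallel⇒≡
    L≢M : L ≢ M
    L≢M L≡M = L∦M (subst (λ N → parallel L N ≡ true) L≡M (parallel-refl L))
    meet≢0 : meet L M ≢ 0
    meet≢0 with q , q∈LM ← ¬disjoint⇒common-point (¬-not λ L∥M →
                              L∦M (trans (cong (L == M ∨_) L∥M) (∨-zeroʳ (L == M))))
      = count-positive q q∈LM

  parallelClasses : ParallelClasses (n * n) n
  parallelClasses = record
    { collinear       = collinear
    ; line-size       = λ i x → line-size (parallelThrough i x)
    ; collinear-sym   = collinear-sym
    ; collinear-trans = collinear-trans
    ; unique-class    = unique-class
    ; transversal     = transversal
    }

-- Differences modulo N

data AddMod (N a b c : ℕ) : Set where
  exact : a + b ≡ c     → AddMod N a b c
  wraps : a + b ≡ N + c → AddMod N a b c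

private
  N+c≢a : ∀ {N a} c → a < N → N + c ≢ a
  N+c≢a {N} c a<N N+c≡a = m+n≮m N c (subst (_< N) (sym N+c≡a) a<N)

  N+a≡a′ : ∀ {N a a′ b c} → a + b ≡ c → a′ + b ≡ N + c → N + a ≡ a′
  N+a≡a′ {N} {a} {b = b} p q = +-cancelʳ-≡ b _ _ (trans (+-assoc N a b) (trans (cong (N +_) p) (sym q)))

addMod-comm : ∀ {N a b c} → AddMod N a b c → AddMod N b a c
addMod-comm {a = a} {b} (exact p) = exact (trans (+-comm b a) p)
addMod-comm {a = a} {b} (wraps p) = wraps (trans (+-comm b a) p)

addMod-functional : ∀ {N a b c c′} → c < N → c′ < N → AddMod N a b c → AddMod N a b c′ → c ≡ c′
addMod-functional _ _ (exact p) (exact q) = trans (sym p) q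
addMod-functional {N} _ _ (wraps p) (wraps q) = +-cancelˡ-≡ N _ _ (trans (sym p) q)
addMod-functional {c′ = c′} c<N _ (exact p) (wraps q) = contradiction (trans (sym q) p) (N+c≢a c′ c<N)
addMod-functional {c = c} _ c′<N (wraps p) (exact q) = contradiction (trans (sym p) q) (N+c≢a c c′<N)

addMod-cancelʳ : ∀ {N a a′ b c} → a < N → a′ < N → AddMod N a b c → AddMod N a′ b c → a ≡ a′
addMod-cancelʳ {b = b} _ _ (exact p) (exact q) = +-cancelʳ-≡ b _ _ (trans p (sym q))
addMod-cancelʳ {b = b} _ _ (wraps p) (wraps q) = +-cancelʳ-≡ b _ _ (trans p (sym q))
addMod-cancelʳ _ a′<N (exact p) (wraps q) = contradiction (N+a≡a′ p q) (N+c≢a _ a′<N)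
addMod-cancelʳ a<N _ (wraps p) (exact q) = contradiction (N+a≡a′ q p) (N+c≢a _ a<N)

addMod-sum : ∀ {N a b} → a < N → b < N → ∃ λ c → c < N × AddMod N a b c
addMod-sum {N} {a} {b} a<N b<N with a + b <? N
... | yes a+b<N = a + b , a+b<N , exact refl
... | no  a+b≮N = a + b ∸ N , +-cancelˡ-< N _ _ (subst (_< N + N) (sym N+[a+b∸N]≡a+b) (+-mono-< a<N b<N))
                            , wraps (sym N+[a+b∸N]≡a+b)
  where
  N+[a+b∸N]≡a+b : N + (a + b ∸ N) ≡ a + b
  N+[a+b∸N]≡a+b = m+[n∸m]≡n (≮⇒≥ a+b≮N)

addMod-difference : ∀ {N b c} → b < N → c < N → ∃ λ a → a < N × AddMod N a b c
addMod-difference {N} {b} {c} b<N c<N with b ≤? c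
... | yes b≤c = c ∸ b , ≤-<-trans (m∸n≤m c b) c<N , exact (m∸n+n≡m b≤c)
... | no  b≰c = N + c ∸ b
              , subst (N + c ∸ b <_) (m+n∸n≡m N b) (∸-monoˡ-< (+-monoʳ-< N (≰⇒> b≰c)) b≤N+c)
              , wraps (m∸n+n≡m b≤N+c)
  where
  b≤N+c : b ≤ N + c
  b≤N+c = ≤-trans (<⇒≤ b<N) (m≤m+n N c)

difference : ∀ {N} (c d : Fin N) → Σ (Fin N) λ t → AddMod N (toℕ t) (toℕ d) (toℕ c)
difference c d with a , a<N , a+d≡c ← addMod-difference (Finₚ.toℕ<n d) (Finₚ.toℕ<n c) =
  fromℕ< a<N , subst (λ x → AddMod _ x (toℕ d) (toℕ c)) (sym (Finₚ.toℕ-fromℕ< a<N)) a+d≡c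

_⊖_ : ∀ {N} → Fin N → Fin N → Fin N
c ⊖ d = proj₁ (difference c d)

⊖-addMod : ∀ {N} (c d : Fin N) → AddMod N (toℕ (c ⊖ d)) (toℕ d) (toℕ c)
⊖-addMod c d = proj₂ (difference c d)

⊖-cancelˡ : ∀ {N} {c d e : Fin N} → c ⊖ d ≡ c ⊖ e → d ≡ e
⊖-cancelˡ {N} {c} {d} {e} eq = Finₚ.toℕ-injective (addMod-cancelʳ (Finₚ.toℕ<n d) (Finₚ.toℕ<n e)
  (addMod-comm (⊖-addMod c d))
  (addMod-comm (subst (λ t → AddMod N (toℕ t) (toℕ e) (toℕ c)) (sym eq) (⊖-addMod c e))))

⊖-cancelʳ : ∀ {N} {c c′ d : Fin N} → c ⊖ d ≡ c′ ⊖ d → c ≡ c′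
⊖-cancelʳ {N} {c} {c′} {d} eq = Finₚ.toℕ-injective (addMod-functional (Finₚ.toℕ<n c) (Finₚ.toℕ<n c′)
  (⊖-addMod c d) (subst (λ t → AddMod N (toℕ t) (toℕ d) (toℕ c′)) (sym eq) (⊖-addMod c′ d)))

⊖≡0⇒≡ : ∀ {N} {c d : Fin (suc N)} → c ⊖ d ≡ zero → c ≡ d
⊖≡0⇒≡ {N} {c} {d} eq = Finₚ.toℕ-injective (addMod-functional (Finₚ.toℕ<n c) (Finₚ.toℕ<n d)
  (subst (λ t → AddMod (suc N) (toℕ t) (toℕ d) (toℕ c)) eq (⊖-addMod c d)) (exact refl))

⊖-surjectiveˡ : ∀ {N} (d t : Fin N) → ∃ λ c → c ⊖ d ≡ t
⊖-surjectiveˡ {N} d t with c , c<N , t+d≡c ← addMod-sum (Finₚ.toℕ<n t) (Finₚ.toℕ<n d) =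
  fromℕ< c<N , Finₚ.toℕ-injective (addMod-cancelʳ (Finₚ.toℕ<n (fromℕ< c<N ⊖ d)) (Finₚ.toℕ<n t)
    (⊖-addMod (fromℕ< c<N) d)
    (subst (AddMod N (toℕ t) (toℕ d)) (sym (Finₚ.toℕ-fromℕ< c<N)) t+d≡c))

⊖-self : ∀ {N} (c : Fin (suc N)) → c ⊖ c ≡ zero
⊖-self c = Finₚ.toℕ-injective (addMod-cancelʳ (Finₚ.toℕ<n (c ⊖ c)) (s≤s z≤n) (⊖-addMod c c) (exact refl))

-- offset c d = ((c − d) mod (n + 2)) − 1; pinch zero subtracts one and sends
-- the residue 0, which only arises for c = d, to the junk value zero.
offset : ∀ {n} → Fin (suc (suc n)) → Fin (suc (suc n)) → Fin (suc n)
offset c d = pinch zero (c ⊖ d)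

private
  pinch-zero-injective : ∀ {n} {j k : Fin (suc (suc n))} → j ≢ zero → k ≢ zero →
                         pinch zero j ≡ pinch zero k → j ≡ k
  pinch-zero-injective {j = zero}  j≢0 _   _  = contradiction refl j≢0
  pinch-zero-injective {k = zero}  _   k≢0 _  = contradiction refl k≢0
  pinch-zero-injective {j = suc _} {suc _} _ _ eq = cong suc eq

offset-injectiveʳ : ∀ {n} {c d e : Fin (suc (suc n))} → c ≢ d → c ≢ e →
                    offset c d ≡ offset c e → d ≡ e
offset-injectiveʳ {c = c} {d} {e} c≢d c≢e =
  ⊖-cancelˡ {c = c} {d} {e} ∘ pinch-zero-injective (c≢d ∘ ⊖≡0⇒≡) (c≢e ∘ ⊖≡0⇒≡)

offset-injectiveˡ : ∀ {n} {c c′ d : Fin (suc (suc n))} → c ≢ d → c′ ≢ d →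
                    offset c d ≡ offset c′ d → c ≡ c′
offset-injectiveˡ {c = c} {c′} {d} c≢d c′≢d =
  ⊖-cancelʳ {c = c} {c′} {d} ∘ pinch-zero-injective (c≢d ∘ ⊖≡0⇒≡) (c′≢d ∘ ⊖≡0⇒≡)

offset-surjectiveˡ : ∀ {n} (d : Fin (suc (suc n))) (i : Fin (suc n)) → ∃ λ c → c ≢ d × offset c d ≡ i
offset-surjectiveˡ d i with c , c⊖d≡1+i ← ⊖-surjectiveˡ d (suc i) =
  c , (λ { refl → Finₚ.0≢1+n (trans (sym (⊖-self c)) c⊖d≡1+i) }) , cong (pinch zero) c⊖d≡1+i

-- The coloured design

module ColouredDesign {v n : ℕ} (R : ParallelClasses v n) where
  open ParallelClasses R
  open ≡-Reasoning

  ℓ : ℕ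
  ℓ = suc (suc n)

  inBlock : Fin ℓ → Fin v → Fin ℓ → Fin v → Bool
  inBlock c p d x = not (c == d) ∧ collinear (offset c d) p x

  blockᶠ : Fin (ℓ * v) → Fin (ℓ * v) → Bool
  blockᶠ = uncurryᶠ (λ c p → uncurryᶠ (inBlock c p))

  block : Fin (ℓ * v) → Subset (ℓ * v)
  block = Vec.tabulate ∘ blockᶠ

  design : Design (ℓ * v)
  design = List.tabulate block

  colour : Fin (ℓ * v) → Fin ℓ
  colour = quotient v

  block-size : ∀ c p → count (uncurryᶠ (inBlock c p)) ≡ suc n * n
  block-size c p = begin
    count (uncurryᶠ (inBlock c p))
      ≡⟨ count-uncurryᶠ (inBlock c p) ⟩
    sum (λ d → count (inBlock c p d))
      ≡⟨ sum-cong-≗ (λ d → trans (count-∧ˡ (not (c == d)) (collinear (offset c d) p))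
                                 (cong (indicator (not (c == d)) *_) (line-size (offset c d) p))) ⟩
    sum (λ d → indicator (not (c == d)) * n)
      ≡⟨ *-distribʳ-sum n (λ d → indicator (not (c == d))) ⟨
    count (λ d → not (c == d)) * n
      ≡⟨ cong (_* n) (count-cong (λ d → cong not (==-sym c d))) ⟩
    count (λ d → not (d == c)) * n
      ≡⟨ cong (_* n) (count-≢ c) ⟩
    suc n * n ∎

  colour-class-size : ∀ c p c′ →
    colourCount colour c′ (Vec.tabulate (uncurryᶠ (inBlock c p))) ≡ indicator (not (c == c′)) * n
  colour-class-size c p c′ = begin
    colourCount colour c′ (Vec.tabulate (uncurryᶠ (inBlock c p)))
      ≡⟨ ∣tabulate∩tabulate∣ (uncurryᶠ (inBlock c p)) (λ z → colour z == c′) ⟩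
    count (λ z → uncurryᶠ (inBlock c p) z ∧ colour z == c′)
      ≡⟨ count-quotient (inBlock c p) c′ ⟩
    count (inBlock c p c′)
      ≡⟨ count-∧ˡ (not (c == c′)) (collinear (offset c c′) p) ⟩
    indicator (not (c == c′)) * count (collinear (offset c c′) p)
      ≡⟨ cong (indicator (not (c == c′)) *_) (line-size (offset c c′) p) ⟩
    indicator (not (c == c′)) * n ∎

  common-blocks : Fin ℓ → Fin v → Fin ℓ → Fin v → ℕ
  common-blocks d x e y = sum (λ c → count (λ p → inBlock c p d x ∧ inBlock c p e y))

  meet-count : ∀ c d x e y → count (λ p → inBlock c p d x ∧ inBlock c p e y)
             ≡ indicator (not (c == d) ∧ not (c == e))
               * count (λ p → collinear (offset c d) x p ∧ collinear (offset c e) y p)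
  meet-count c d x e y = trans (count-cong λ p →
      trans (∧-interchange (not (c == d)) (collinear (offset c d) p x) (not (c == e)) (collinear (offset c e) p y))
            (cong₂ (λ u w → (not (c == d) ∧ not (c == e)) ∧ (u ∧ w))
                   (collinear-sym (offset c d) p x) (collinear-sym (offset c e) p y)))
    (count-∧ˡ (not (c == d) ∧ not (c == e)) (λ p → collinear (offset c d) x p ∧ collinear (offset c e) y p))

  offset-unique-class : ∀ {x y} → x ≢ y → ∀ d → count (λ c → not (c == d) ∧ collinear (offset c d) x y) ≡ 1
  offset-unique-class {x} {y} x≢y d
    with i₀ , x~y ← count≡1⇒∃ (unique-class x≢y)
    with c₀ , c₀≢d , c₀↦i₀ ← offset-surjectiveˡ d i₀
    = count-unique c₀ (cong₂ _∧_ (cong not (==-≢ c₀≢d)) (trans (cong (λ i → collinear i x y) c₀↦i₀) x~y))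
                   unique
    where
    unique : ∀ c → (not (c == d) ∧ collinear (offset c d) x y) ≡ true → c ≡ c₀
    unique c holds with c≁d , c~ ← ∧-true⁻ holds =
      offset-injectiveˡ (==-false⇒≢ (not-injective c≁d)) c₀≢d
        (trans (count≡1⇒unique (unique-class x≢y) c~ x~y) (sym c₀↦i₀))

  same-colour-pairs : ∀ d {x y} → x ≢ y → common-blocks d x d y ≡ n
  same-colour-pairs d {x} {y} x≢y = begin
    common-blocks d x d y
      ≡⟨ sum-cong-≗ (λ c → trans (meet-count c d x d y) (term c)) ⟩
    sum (λ c → indicator (not (c == d) ∧ collinear (offset c d) x y) * n)
      ≡⟨ *-distribʳ-sum n (λ c → indicator (not (c == d) ∧ collinear (offset c d) x y)) ⟨
    count (λ c → not (c == d) ∧ collinear (offset c d) x y) * n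
      ≡⟨ cong (_* n) (offset-unique-class x≢y d) ⟩
    1 * n
      ≡⟨ *-identityˡ n ⟩
    n ∎
    where
    term : ∀ c → indicator (not (c == d) ∧ not (c == d))
                 * count (λ p → collinear (offset c d) x p ∧ collinear (offset c d) y p)
               ≡ indicator (not (c == d) ∧ collinear (offset c d) x y) * n
    term c = begin
      indicator (a ∧ a) * count (λ p → collinear i x p ∧ collinear i y p)
        ≡⟨ cong₂ (λ b k → indicator b * k) (∧-idem a) (common-points i x y) ⟩
      indicator a * (indicator (collinear i x y) * n)
        ≡⟨ *-assoc (indicator a) (indicator (collinear i x y)) n ⟨
      indicator a * indicator (collinear i x y) * n
        ≡⟨ cong (_* n) (indicator-∧ a (collinear i x y)) ⟨
      indicator (a ∧ collinear i x y) * n ∎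
      where
      a = not (c == d)
      i = offset c d

  different-colour-pairs : ∀ {d e} → d ≢ e → ∀ x y → common-blocks d x e y ≡ n
  different-colour-pairs {d} {e} d≢e x y = begin
    common-blocks d x e y
      ≡⟨ sum-cong-≗ (λ c → trans (meet-count c d x e y) (term c)) ⟩
    count (λ c → not (c == d) ∧ not (c == e))
      ≡⟨ count-remove (λ c → not (c == d)) e (cong not (==-≢ (d≢e ∘ sym))) ⟩
    count (λ c → not (c == d)) ∸ 1
      ≡⟨ cong (_∸ 1) (count-≢ d) ⟩
    n ∎
    where
    term : ∀ c → indicator (not (c == d) ∧ not (c == e))
                 * count (λ p → collinear (offset c d) x p ∧ collinear (offset c e) y p)
               ≡ indicator (not (c == d) ∧ not (c == e))
    term c with c == d in c=d | c == e in c=e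
    ... | true  | _     = refl
    ... | false | true  = refl
    ... | false | false = trans (+-identityʳ _)
      (transversal (d≢e ∘ offset-injectiveʳ (==-false⇒≢ c=d) (==-false⇒≢ c=e)) x y)

  common-blocks-≢ : ∀ d x e y → (d , x) ≢ (e , y) → common-blocks d x e y ≡ n
  common-blocks-≢ d x e y dx≢ey with d ≟ e
  ... | yes refl = same-colour-pairs d (dx≢ey ∘ cong (d ,_))
  ... | no  d≢e  = different-colour-pairs d≢e x y

  pair-count : ∀ X Y → X ≢ Y → pairCount design X Y ≡ n
  pair-count X Y X≢Y = begin
    pairCount design X Y
      ≡⟨ length-filter-tabulate (λ B → (X ∈? B) ×-dec (Y ∈? B)) block ⟩
    count (λ b → does (X ∈? block b) ∧ does (Y ∈? block b))
      ≡⟨ count-cong (λ b → cong₂ _∧_ (does-∈?-tabulate X (blockᶠ b)) (does-∈?-tabulate Y (blockᶠ b))) ⟩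
    count (uncurryᶠ (λ c p → uncurryᶠ (inBlock c p) X ∧ uncurryᶠ (inBlock c p) Y))
      ≡⟨ count-uncurryᶠ (λ c p → uncurryᶠ (inBlock c p) X ∧ uncurryᶠ (inBlock c p) Y) ⟩
    sum (λ c → count (λ p → uncurryᶠ (inBlock c p) X ∧ uncurryᶠ (inBlock c p) Y))
      ≡⟨ common-blocks-≢ _ _ _ _ (X≢Y ∘ remQuot-injective v) ⟩
    n ∎

  isBIBD : 1 ≤ n → n ≤ v → IsBIBD (ℓ * v) (suc n * n) n design
  isBIBD 1≤n n≤v = record
    { k≥2       = *-mono-≤ (s≤s 1≤n) 1≤n
    ; k<v       = <-≤-trans (*-monoˡ-< n {{>-nonZero 1≤n}} (n<1+n (suc n))) (*-monoʳ-≤ ℓ n≤v)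
    ; blockSize = tabulate⁺ λ b → trans (∣tabulate∣ (blockᶠ b)) (uncurry block-size (remQuot v b))
    ; balanced  = pair-count
    }

  isZeroULSE : 1 ≤ n → n ≤ v → IsZeroULSE (suc n * n) ℓ design colour
  isZeroULSE 1≤n n≤v = record
    { surjective = λ c → combine c p₀ , cong proj₁ (Finₚ.remQuot-combine c p₀)
    ; divides    = m∣m*n n
    ; perBlock   = tabulate⁺ λ b → uncurry missing-colour (remQuot v b)
    }
    where
    p₀ : Fin v
    p₀ = fromℕ< (≤-trans 1≤n n≤v)
    missing-colour : ∀ c p → Σ (Fin ℓ) λ c₀ → colourCount colour c₀ (Vec.tabulate (uncurryᶠ (inBlock c p))) ≡ 0
                     × (∀ c′ → c′ ≢ c₀ → colourCount colour c′ (Vec.tabulate (uncurryᶠ (inBlock c p))) ≡ n)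
    missing-colour c p = c
      , trans (colour-class-size c p c) (cong (λ b → indicator (not b) * n) (==-refl c))
      , λ c′ c′≢c → trans (colour-class-size c p c′)
                      (trans (cong (λ b → indicator (not b) * n) (==-≢ (c′≢c ∘ sym))) (+-identityʳ n))

theorem5p7 : ∀ (ℓ : ℕ) → 1 ≤ ℓ → AffinePlane (ℓ ∸ 2) →
    Σ (Design (ℓ * ((ℓ ∸ 2) * (ℓ ∸ 2)))) λ 𝓑 →
      IsBIBD (ℓ * ((ℓ ∸ 2) * (ℓ ∸ 2))) ((ℓ ∸ 1) * (ℓ ∸ 2)) (ℓ ∸ 2) 𝓑
      × Σ (Fin (ℓ * ((ℓ ∸ 2) * (ℓ ∸ 2))) → Fin ℓ) λ col →
          IsZeroULSE ((ℓ ∸ 1) * (ℓ ∸ 2)) ℓ 𝓑 col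
theorem5p7 zero          ()
theorem5p7 (suc zero)    _ (_ , plane) = contradiction (IsBIBD.k≥2 plane) λ ()
theorem5p7 (suc (suc n)) _ (_ , plane) =
  design , isBIBD 1≤n n≤n*n , colour , isZeroULSE 1≤n n≤n*n
  where
  open ColouredDesign (AffinePlaneGeometry.parallelClasses plane)
  1≤n : 1 ≤ n
  1≤n = ≤-trans (s≤s z≤n) (IsBIBD.k≥2 plane)
  n≤n*n : n ≤ n * n
  n≤n*n = m≤m*n n n {{>-nonZero 1≤n}}
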